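{- Let $\ell\ge1$, $B=(b_1,\ldots,b_\ell)$ with integers $b_i\ge2$, $u\in\Sigma_B$ and $v\in\Delta_B$, and let $P=\{i: v_i\ne g,\ v_i=u_i\}$, $Q=\{i: v_i\ne g,\ v_i\ne u_i\}$. (i) For $1\le i\le\ell$ with $v_i\ne g$ (i.e. $i\in P\cup Q$), let $\displaystyle\phi_i(u,v)=\sum_{j=\max\{1,v_i\}}^{b_i-1}\frac{\nu_i(v_i,j)\nu_i(u_i,j)}{j(j+1)}$. Then $\phi_i(u,v)=\frac{b_i-1}{b_i}$ if $i\in P$ and $\phi_i(u,v)=\frac{ -1}{b_i}$ if $i\in Q$. (ii) Let $G\subseteq[\ell]$ with $G_v\subseteq G$. Then $$\sum_{v'\in\Gamma_B,\ G_{v'}=G}\frac{\nu_B(v,v')\nu_B(u,v')}{\prod_{i\in\overline G_{v'}}(v'_i+{v'_i}^2)}=\frac{(-1)^{|Q\setminus G|+|G_v|}\prod_{i\in G_v}b_i\prod_{i\in P\setminus G}(b_i-1)}{\prod_{i\in[\ell]\setminus G}b_i}.$$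
   Context: For an integer $b\ge2$ let $\Sigma_b=\{0,\ldots,b-1\}$, $\Delta_b=\Sigma_b\cup\{g\}$ with $g$ a gap symbol, $\Gamma_b=\Delta_b\setminus\{0\}$; $\Sigma_B,\Delta_B,\Gamma_B$ are the products over $b_1,\ldots,b_\ell$, elements written as words $v_1\cdots v_\ell$. For $v\in\Delta_B$, $G_v=\{i: v_i=g\}$, $\overline G_v=[\ell]\setminus G_v$. On $\Delta_{b_i}$ use the order $0\prec1\prec\cdots\prec b_i-1\prec g$, and set $\nu_i(x,y)=-b_i$ if $x=y=g$; $-y$ if $x=y\ne g$; $1$ if $x\prec y$; $0$ if $y\prec x$; and $\nu_B(x,y)=\prod_{i=1}^\ell\nu_i(x_i,y_i)$ for $x,y\in\Delta_B$. -}

module Defs where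

open import Data.Nat as ℕ using (ℕ; zero; suc; _⊔_)
open import Data.Integer as ℤ using (ℤ; +_)
open import Data.Rational as ℚ using (ℚ; 0ℚ; 1ℚ; _+_; _*_; -_; 1/_; _/_)
open import Data.Rational.Properties as ℚP using ()
open import Data.Fin as Fin using (Fin; zero; suc; toℕ)
open import Data.Fin.Subset using (Subset)
open import Data.Bool using (Bool; true; false; if_then_else_; _∧_; not)
open import Data.List using (List; []; _∷_; map; foldr; concatMap; filterᵇ; allFin)
open import Data.Vec as Vec using (Vec; lookup; tabulate)
open import Data.Vec.Properties using (≡-dec)
import Data.Bool.Properties as BoolP
open import Relation.Nullary using (yes; no)
open import Relation.Nullary.Decidable using (⌊_⌋)

-- Δ_b = Σ_b ∪ {g} : a digit in {0,…,b-1} or the gap symbol g.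

data Δ (b : ℕ) : Set where
  dig : Fin b → Δ b
  gap : Δ b

-- Position of an element in the order 0 ≺ 1 ≺ ⋯ ≺ b-1 ≺ g
-- (for a digit this is its numerical value).
rank : ∀ {b} → Δ b → ℕ
rank (dig x) = toℕ x
rank {b} gap = b

isGap : ∀ {b} → Δ b → Bool
isGap (dig _) = false
isGap gap     = true

isZeroDigit : ∀ {b} → Δ b → Bool
isZeroDigit (dig zero)    = true
isZeroDigit (dig (suc _)) = false
isZeroDigit gap           = false

eqΔ : ∀ {b} → Δ b → Δ b → Bool
eqΔ (dig x) (dig y) = ⌊ x Fin.≟ y ⌋
eqΔ gap     gap     = true
eqΔ _       _       = false

ℕ→ℚ : ℕ → ℚ
ℕ→ℚ n = + n / 1

-- total reciprocal (only ever applied to nonzero arguments in the statement)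
recip : ℚ → ℚ
recip p with p ℚP.≟ 0ℚ
... | yes _  = 0ℚ
... | no p≢0 = 1/_ p {{ℚ.≢-nonZero p≢0}}

_÷ₜ_ : ℚ → ℚ → ℚ
p ÷ₜ q = p * recip q

negOnePow : ℕ → ℚ
negOnePow zero    = 1ℚ
negOnePow (suc n) = - negOnePow n

sumℚ : List ℚ → ℚ
sumℚ = foldr _+_ 0ℚ

prodℚ : List ℚ → ℚ
prodℚ = foldr _*_ 1ℚ

ν : (b : ℕ) → Δ b → Δ b → ℚ
ν b gap     gap     = - ℕ→ℚ b
ν b (dig x) (dig y) with x Fin.≟ y
... | yes _ = - ℕ→ℚ (toℕ y)
... | no  _ = if ⌊ toℕ x ℕ.<? toℕ y ⌋ then 1ℚ else 0ℚ
ν b (dig x) gap     = 1ℚ      -- x ≺ g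
ν b gap     (dig y) = 0ℚ      -- y ≺ g

ΣB : (ℓ : ℕ) → (Fin ℓ → ℕ) → Set
ΣB ℓ B = (i : Fin ℓ) → Fin (B i)

ΔB : (ℓ : ℕ) → (Fin ℓ → ℕ) → Set
ΔB ℓ B = (i : Fin ℓ) → Δ (B i)

embed : ∀ {ℓ B} → ΣB ℓ B → ΔB ℓ B
embed u i = dig (u i)

isΓ : ∀ {ℓ B} → ΔB ℓ B → Bool
isΓ {ℓ} v = foldr _∧_ true (map (λ i → not (isZeroDigit (v i))) (allFin ℓ))

Gof : ∀ {ℓ B} → ΔB ℓ B → Subset ℓ
Gof v = tabulate (λ i → isGap (v i))

Pset : ∀ {ℓ B} → ΣB ℓ B → ΔB ℓ B → Subset ℓ
Pset u v = tabulate (λ i → not (isGap (v i)) ∧ eqΔ (v i) (dig (u i)))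

Qset : ∀ {ℓ B} → ΣB ℓ B → ΔB ℓ B → Subset ℓ
Qset u v = tabulate (λ i → not (isGap (v i)) ∧ not (eqΔ (v i) (dig (u i))))

νB : ∀ {ℓ} (B : Fin ℓ → ℕ) → ΔB ℓ B → ΔB ℓ B → ℚ
νB {ℓ} B x y = prodℚ (map (λ i → ν (B i) (x i) (y i)) (allFin ℓ))

prodOver : ∀ {ℓ} → Subset ℓ → (Fin ℓ → ℚ) → ℚ
prodOver {ℓ} S f = prodℚ (map (λ i → if lookup S i then f i else 1ℚ) (allFin ℓ))

-- explicit enumeration of Δ_b and of Δ_B (each element exactly once)
allΔ : (b : ℕ) → List (Δ b)
allΔ b = gap ∷ map dig (allFin b)

consΔ : ∀ {ℓ} {B : Fin (suc ℓ) → ℕ} → Δ (B zero) → ΔB ℓ (λ i → B (suc i)) → ΔB (suc ℓ) B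
consΔ x f zero    = x
consΔ x f (suc i) = f i

allΔB : (ℓ : ℕ) (B : Fin ℓ → ℕ) → List (ΔB ℓ B)
allΔB zero    B = (λ ()) ∷ []
allΔB (suc ℓ) B =
  concatMap (λ x → map (consΔ {B = B} x) (allΔB ℓ (λ i → B (suc i)))) (allΔ (B zero))

φ : (b : ℕ) → Fin b → Δ b → ℚ
φ b ui vi =
  sumℚ (map (λ j → (ν b vi (dig j) * ν b (dig ui) (dig j))
                     ÷ₜ ℕ→ℚ (toℕ j ℕ.* suc (toℕ j)))
            (filterᵇ (λ j → ⌊ (1 ⊔ rank vi) ℕ.≤? toℕ j ⌋) (allFin b)))

lhsII : ∀ {ℓ} (B : Fin ℓ → ℕ) → ΣB ℓ B → ΔB ℓ B → Subset ℓ → ℚ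
lhsII {ℓ} B u v G =
  sumℚ (map (λ v' → (νB B v v' * νB B (embed u) v')
                     ÷ₜ prodOver (Data.Fin.Subset.∁ (Gof v'))
                          (λ i → ℕ→ℚ (rank (v' i) ℕ.+ rank (v' i) ℕ.* rank (v' i))))
            (filterᵇ (λ v' → isΓ v' ∧ ⌊ ≡-dec BoolP._≟_ (Gof v') G ⌋) (allΔB ℓ B)))

{-# OPTIONS --safe #-}
module Submission where

-- (i) Since 1/(j(j+1)) = 1/j − 1/(j+1), the sum φ_i telescopes. Put m = max(v_i, u_i):
-- below m one of the factors ν vanishes, the term at m is 1 − 1/(m+1) if v_i = u_i and
-- −1/(m+1) otherwise, and the terms above m add up to 1/(m+1) − 1/b_i.
-- (ii) Summand and range of the sum over v′ factor over the coordinates, and so does the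
-- right-hand side. For i ∈ G the only admissible letter is v′_i = g, with factor
-- ν_i(v_i,g) ν_i(u_i,g) = −b_i or 1 according as v_i = g or not; for i ∉ G the letter v′_i
-- runs over the nonzero digits and the factor is φ_i(u,v), evaluated in (i).

open import Defs
open import Algebra.Bundles using (CommutativeMonoid)
import Algebra.Properties.CommutativeSemigroup as CommutativeSemigroupProperties
open import Data.Bool using (Bool; true; false; if_then_else_; _∧_; not)
import Data.Bool.Properties as BoolP
open import Data.Empty using (⊥-elim)
open import Data.Fin as Fin using (Fin; zero; suc; toℕ)
import Data.Fin.Properties as FinP
open import Data.Fin.Subset using (Subset; _⊆_; _─_; ∁; ∣_∣)
open import Data.Fin.Subset.Properties using (drop-∷-⊆)
open import Data.Integer as ℤ using (+_)
import Data.Integer.Properties as ℤP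
open import Data.List using ([]; _∷_; _++_; map; foldr; concatMap; filterᵇ; allFin; tabulate; applyUpTo)
import Data.List.Properties as ListP
open import Data.Nat as ℕ using (ℕ; zero; suc; _+_; _≤_; _<_; _∸_; _⊔_; s≤s)
import Data.Nat.Properties as ℕP
open import Data.Nat.Coprimality as Coprime using (1-coprimeTo)
open import Data.Product using (_×_; _,_)
open import Data.Rational as ℚ using (ℚ; mkℚ; 0ℚ; 1ℚ; _*_; -_; _-_)
import Data.Rational.Properties as ℚP
open import Data.Rational.Solver using (module +-*-Solver)
open import Data.Rational.Unnormalised as ℚᵘ using (*≡*)
import Data.Rational.Unnormalised.Properties as ℚᵘP
open import Data.Sum using (inj₁; inj₂)
open import Data.Vec using ([]; _∷_; head; here; lookup)
open import Data.Vec.Properties using (≡-dec)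
open import Function using (_∘_; id)
open import Relation.Binary using (tri<; tri≈; tri>)
open import Relation.Binary.PropositionalEquality using (_≡_; _≢_; refl; sym; trans; cong; cong₂; subst; module ≡-Reasoning)
open import Relation.Nullary using (yes; no; _×-dec_)
open import Relation.Nullary.Decidable using (⌊_⌋; isYes≗does; ⌊⌋-map′; toSum)

open ≡-Reasoning
open +-*-Solver

-- Arithmetic in ℚ

ℕ→ℚ≡mkℚ : ∀ n → ℕ→ℚ n ≡ mkℚ (+ n) 0 (Coprime.sym (1-coprimeTo n))
ℕ→ℚ≡mkℚ n = ℚP.normalize-coprime (Coprime.sym (1-coprimeTo n))

ℕ→ℚ-homo-+ : ∀ m n → ℕ→ℚ (m + n) ≡ ℕ→ℚ m ℚ.+ ℕ→ℚ n
ℕ→ℚ-homo-+ m n =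
  ℚP.toℚᵘ-injective (ℚᵘP.≃-trans sum (ℚᵘP.≃-sym (ℚP.toℚᵘ-homo-+ (ℕ→ℚ m) (ℕ→ℚ n))))
  where
  sum : ℚ.toℚᵘ (ℕ→ℚ (m + n)) ℚᵘ.≃ ℚ.toℚᵘ (ℕ→ℚ m) ℚᵘ.+ ℚ.toℚᵘ (ℕ→ℚ n)
  sum rewrite ℕ→ℚ≡mkℚ m | ℕ→ℚ≡mkℚ n | ℕ→ℚ≡mkℚ (m + n) =
    *≡* (cong (ℤ._* + 1) (trans (ℤP.pos-+ m n)
      (sym (cong₂ ℤ._+_ (ℤP.*-identityʳ (+ m)) (ℤP.*-identityʳ (+ n))))))

ℕ→ℚ-homo-* : ∀ m n → ℕ→ℚ (m ℕ.* n) ≡ ℕ→ℚ m * ℕ→ℚ n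
ℕ→ℚ-homo-* m n =
  ℚP.toℚᵘ-injective (ℚᵘP.≃-trans prod (ℚᵘP.≃-sym (ℚP.toℚᵘ-homo-* (ℕ→ℚ m) (ℕ→ℚ n))))
  where
  prod : ℚ.toℚᵘ (ℕ→ℚ (m ℕ.* n)) ℚᵘ.≃ ℚ.toℚᵘ (ℕ→ℚ m) ℚᵘ.* ℚ.toℚᵘ (ℕ→ℚ n)
  prod rewrite ℕ→ℚ≡mkℚ m | ℕ→ℚ≡mkℚ n | ℕ→ℚ≡mkℚ (m ℕ.* n) = *≡* (cong (ℤ._* + 1) (ℤP.pos-* m n))

ℕ→ℚ-suc≢0 : ∀ n → ℕ→ℚ (suc n) ≢ 0ℚ
ℕ→ℚ-suc≢0 n eq with trans (sym (ℕ→ℚ≡mkℚ (suc n))) eq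
... | ()

recip-inverseˡ : ∀ p → p ≢ 0ℚ → recip p * p ≡ 1ℚ
recip-inverseˡ p p≢0 with p ℚP.≟ 0ℚ
... | yes p≡0 = ⊥-elim (p≢0 p≡0)
... | no p≢0′ = ℚP.*-inverseˡ p {{ℚ.≢-nonZero p≢0′}}

recip-unique : ∀ p q → q * p ≡ 1ℚ → recip p ≡ q
recip-unique p q q*p≡1 = begin
  recip p                ≡⟨ sym (ℚP.*-identityʳ (recip p)) ⟩
  recip p * 1ℚ           ≡⟨ cong (recip p *_) (sym q*p≡1) ⟩
  recip p * (q * p)      ≡⟨ solve 3 (λ r q p → r :* (q :* p) := q :* (r :* p)) refl (recip p) q p ⟩
  q * (recip p * p)      ≡⟨ cong (q *_) (recip-inverseˡ p p≢0) ⟩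
  q * 1ℚ                 ≡⟨ ℚP.*-identityʳ q ⟩
  q                      ∎
  where
  p≢0 : p ≢ 0ℚ
  p≢0 refl = ℚP.1≢0 (trans (sym q*p≡1) (ℚP.*-zeroʳ q))

recip-* : ∀ p q → recip (p * q) ≡ recip p * recip q
recip-* p q with toSum (p ℚP.≟ 0ℚ) | toSum (q ℚP.≟ 0ℚ)
... | inj₁ refl | _ = trans (cong recip (ℚP.*-zeroˡ q)) (sym (ℚP.*-zeroˡ (recip q)))
... | inj₂ _ | inj₁ refl = trans (cong recip (ℚP.*-zeroʳ p)) (sym (ℚP.*-zeroʳ (recip p)))
... | inj₂ p≢0 | inj₂ q≢0 = recip-unique (p * q) (recip p * recip q) (begin
  recip p * recip q * (p * q)    ≡⟨ solve 4 (λ r s p q → r :* s :* (p :* q) := (r :* p) :* (s :* q)) refl (recip p) (recip q) p q ⟩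
  (recip p * p) * (recip q * q)  ≡⟨ cong₂ _*_ (recip-inverseˡ p p≢0) (recip-inverseˡ q q≢0) ⟩
  1ℚ * 1ℚ                        ∎)

÷ₜ-* : ∀ p q r s → (p * q) ÷ₜ (r * s) ≡ (p ÷ₜ r) * (q ÷ₜ s)
÷ₜ-* p q r s = begin
  (p * q) * recip (r * s)            ≡⟨ cong ((p * q) *_) (recip-* r s) ⟩
  (p * q) * (recip r * recip s)      ≡⟨ solve 4 (λ p q r s → (p :* q) :* (r :* s) := (p :* r) :* (q :* s)) refl p q (recip r) (recip s) ⟩
  (p * recip r) * (q * recip s)      ∎

recipℕ : ℕ → ℚ
recipℕ n = recip (ℕ→ℚ n)

recipℕ-inverseˡ : ∀ n → recipℕ (suc n) * ℕ→ℚ (suc n) ≡ 1ℚ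
recipℕ-inverseˡ n = recip-inverseˡ (ℕ→ℚ (suc n)) (ℕ→ℚ-suc≢0 n)

recipℕ-suc : ∀ n → recipℕ (suc n) * (1ℚ ℚ.+ ℕ→ℚ n) ≡ 1ℚ
recipℕ-suc n = begin
  recipℕ (suc n) * (1ℚ ℚ.+ ℕ→ℚ n)  ≡⟨ cong (recipℕ (suc n) *_) (sym (ℕ→ℚ-homo-+ 1 n)) ⟩
  recipℕ (suc n) * ℕ→ℚ (suc n)     ≡⟨ recipℕ-inverseˡ n ⟩
  1ℚ                               ∎

recipℕ-partialFraction : ∀ n →
  recipℕ (suc n) * recipℕ (suc (suc n)) ≡ recipℕ (suc n) - recipℕ (suc (suc n))
recipℕ-partialFraction n = begin
  r * s                                          ≡⟨ solve 3 (λ r s x → r :* s := r :* (s :* (con 1ℚ :+ x)) :- s :* (r :* x)) refl r s x ⟩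
  r * (s * (1ℚ ℚ.+ x)) - s * (r * x)             ≡⟨ cong₂ (λ a b → r * a - s * b) (recipℕ-suc (suc n)) (recipℕ-inverseˡ n) ⟩
  r * 1ℚ - s * 1ℚ                                ≡⟨ solve 2 (λ r s → r :* con 1ℚ :- s :* con 1ℚ := r :- s) refl r s ⟩
  r - s                                          ∎
  where
  r = recipℕ (suc n)
  s = recipℕ (suc (suc n))
  x = ℕ→ℚ (suc n)

-- Telescoping sums

sumℚ-++ : ∀ xs ys → sumℚ (xs ++ ys) ≡ sumℚ xs ℚ.+ sumℚ ys
sumℚ-++ []       ys = sym (ℚP.+-identityˡ (sumℚ ys))
sumℚ-++ (x ∷ xs) ys = trans (cong (x ℚ.+_) (sumℚ-++ xs ys)) (sym (ℚP.+-assoc x (sumℚ xs) (sumℚ ys)))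

sumUpTo : ℕ → (ℕ → ℚ) → ℚ
sumUpTo n t = sumℚ (applyUpTo t n)

sumUpTo-suc : ∀ n t → sumUpTo (suc n) t ≡ sumUpTo n t ℚ.+ t n
sumUpTo-suc n t = begin
  sumℚ (applyUpTo t (suc n))               ≡⟨ cong sumℚ (sym (ListP.applyUpTo-∷ʳ t n)) ⟩
  sumℚ (applyUpTo t n ++ t n ∷ [])         ≡⟨ sumℚ-++ (applyUpTo t n) (t n ∷ []) ⟩
  sumUpTo n t ℚ.+ (t n ℚ.+ 0ℚ)             ≡⟨ cong (sumUpTo n t ℚ.+_) (ℚP.+-identityʳ (t n)) ⟩
  sumUpTo n t ℚ.+ t n                      ∎

sumUpTo-vanishing : ∀ n t → (∀ {j} → j < n → t j ≡ 0ℚ) → sumUpTo n t ≡ 0ℚ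
sumUpTo-vanishing zero    t _       = refl
sumUpTo-vanishing (suc n) t t<n≡0 = begin
  sumUpTo (suc n) t          ≡⟨ sumUpTo-suc n t ⟩
  sumUpTo n t ℚ.+ t n        ≡⟨ cong₂ ℚ._+_ (sumUpTo-vanishing n t (t<n≡0 ∘ ℕP.m<n⇒m<1+n)) (t<n≡0 ℕP.≤-refl) ⟩
  0ℚ ℚ.+ 0ℚ                  ≡⟨⟩
  0ℚ                         ∎

sumUpTo-telescoping : ∀ t m K →
  (∀ {j} → j < m → t j ≡ 0ℚ) → t m ≡ K - recipℕ (suc m) →
  (∀ {j} → m < j → t j ≡ recipℕ j * recipℕ (suc j)) →
  ∀ {n} → m < n → sumUpTo n t ≡ K - recipℕ n
sumUpTo-telescoping t m K below at above {suc n} (s≤s m≤n) =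
  subst (λ k → sumUpTo (suc k) t ≡ K - recipℕ (suc k)) (ℕP.m∸n+n≡m m≤n) (beyond (n ∸ m))
  where
  beyond : ∀ k → sumUpTo (suc (k + m)) t ≡ K - recipℕ (suc (k + m))
  beyond zero = begin
    sumUpTo (suc m) t               ≡⟨ sumUpTo-suc m t ⟩
    sumUpTo m t ℚ.+ t m             ≡⟨ cong₂ ℚ._+_ (sumUpTo-vanishing m t below) at ⟩
    0ℚ ℚ.+ (K - recipℕ (suc m))     ≡⟨ ℚP.+-identityˡ _ ⟩
    K - recipℕ (suc m)              ∎
  beyond (suc k) = begin
    sumUpTo (suc (suc k + m)) t                          ≡⟨ sumUpTo-suc (suc (k + m)) t ⟩
    sumUpTo (suc (k + m)) t ℚ.+ t (suc (k + m))          ≡⟨ cong₂ ℚ._+_ (beyond k) (above (s≤s (ℕP.m≤n+m m k))) ⟩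
    (K - r) ℚ.+ r * s                                    ≡⟨ cong ((K - r) ℚ.+_) (recipℕ-partialFraction (k + m)) ⟩
    (K - r) ℚ.+ (r - s)                                  ≡⟨ solve 3 (λ K r s → (K :- r) :+ (r :- s) := K :- s) refl K r s ⟩
    K - s                                                ∎
    where
    r = recipℕ (suc (k + m))
    s = recipℕ (suc (suc (k + m)))

-- The sums φ_i

νℕ : ℕ → ℕ → ℚ
νℕ a c with a ℕ.≟ c
... | yes _ = - ℕ→ℚ c
... | no _  = if ⌊ a ℕ.<? c ⌋ then 1ℚ else 0ℚ

ν-dig : ∀ {b} (x y : Fin b) → ν b (dig x) (dig y) ≡ νℕ (toℕ x) (toℕ y)
ν-dig x y with x Fin.≟ y | toℕ x ℕ.≟ toℕ y
... | yes _    | yes _     = refl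
... | yes refl | no x≢x    = ⊥-elim (x≢x refl)
... | no x≢y   | yes x≡y   = ⊥-elim (x≢y (FinP.toℕ-injective x≡y))
... | no _     | no _      = refl

νℕ-refl : ∀ a → νℕ a a ≡ - ℕ→ℚ a
νℕ-refl a with a ℕ.≟ a
... | yes _   = refl
... | no a≢a  = ⊥-elim (a≢a refl)

νℕ-< : ∀ {a c} → a < c → νℕ a c ≡ 1ℚ
νℕ-< {a} {c} a<c with a ℕ.≟ c
... | yes refl = ⊥-elim (ℕP.<-irrefl refl a<c)
... | no _ with a ℕ.<? c
...   | yes _   = refl
...   | no a≮c  = ⊥-elim (a≮c a<c)

νℕ-> : ∀ {a c} → c < a → νℕ a c ≡ 0ℚ
νℕ-> {a} {c} c<a with a ℕ.≟ c
... | yes refl = ⊥-elim (ℕP.<-irrefl refl c<a)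
... | no _ with a ℕ.<? c
...   | yes a<c = ⊥-elim (ℕP.<-asym a<c c<a)
...   | no _    = refl

digitTerm : ℕ → ℕ → ℕ → ℚ
digitTerm a c j = (νℕ a j * νℕ c j) ÷ₜ ℕ→ℚ (j ℕ.* suc j)

-- ÷ₜ returns 0 on a zero divisor, so the term j = 0, which φ leaves out, vanishes anyway.
digitTerm-zero : ∀ a c → digitTerm a c 0 ≡ 0ℚ
digitTerm-zero a c = ℚP.*-zeroʳ (νℕ a 0 * νℕ c 0)

digitTerm-comm : ∀ a c j → digitTerm a c j ≡ digitTerm c a j
digitTerm-comm a c j = cong (_÷ₜ ℕ→ℚ (j ℕ.* suc j)) (ℚP.*-comm (νℕ a j) (νℕ c j))

digitTerm-split : ∀ a c j → digitTerm a c j ≡ νℕ a j * νℕ c j * (recipℕ j * recipℕ (suc j))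
digitTerm-split a c j =
  cong (νℕ a j * νℕ c j *_) (trans (cong recip (ℕ→ℚ-homo-* j (suc j))) (recip-* (ℕ→ℚ j) (ℕ→ℚ (suc j))))

digitTerm-belowˡ : ∀ {a c j} → j < a → digitTerm a c j ≡ 0ℚ
digitTerm-belowˡ {a} {c} {j} j<a = begin
  (νℕ a j * νℕ c j) ÷ₜ ℕ→ℚ (j ℕ.* suc j)   ≡⟨ cong (λ z → (z * νℕ c j) ÷ₜ ℕ→ℚ (j ℕ.* suc j)) (νℕ-> j<a) ⟩
  (0ℚ * νℕ c j) ÷ₜ ℕ→ℚ (j ℕ.* suc j)       ≡⟨ solve 2 (λ y r → (con 0ℚ :* y) :* r := con 0ℚ) refl (νℕ c j) (recipℕ (j ℕ.* suc j)) ⟩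
  0ℚ                                        ∎

digitTerm-belowʳ : ∀ {a c j} → j < c → digitTerm a c j ≡ 0ℚ
digitTerm-belowʳ {a} {c} {j} j<c = trans (digitTerm-comm a c j) (digitTerm-belowˡ {c} {a} j<c)

digitTerm-below-⊔ : ∀ {a c j} → j < 1 ⊔ a → digitTerm a c j ≡ 0ℚ
digitTerm-below-⊔ {a}     {c} {zero}  _   = digitTerm-zero a c
digitTerm-below-⊔ {suc a} {c} {suc j} j<a = digitTerm-belowˡ {suc a} {c} j<a
digitTerm-below-⊔ {zero}  {c} {suc j} (s≤s ())

digitTerm-above : ∀ {a c j} → a < j → c < j → digitTerm a c j ≡ recipℕ j * recipℕ (suc j)
digitTerm-above {a} {c} {j} a<j c<j = begin
  digitTerm a c j                              ≡⟨ digitTerm-split a c j ⟩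
  νℕ a j * νℕ c j * (recipℕ j * recipℕ (suc j)) ≡⟨ cong₂ (λ x y → x * y * (recipℕ j * recipℕ (suc j))) (νℕ-< a<j) (νℕ-< c<j) ⟩
  1ℚ * 1ℚ * (recipℕ j * recipℕ (suc j))        ≡⟨ solve 1 (λ r → con 1ℚ :* con 1ℚ :* r := r) refl _ ⟩
  recipℕ j * recipℕ (suc j)                    ∎

digitTerm-diag : ∀ a → digitTerm a a a ≡ 1ℚ - recipℕ (suc a)
digitTerm-diag zero    = refl
digitTerm-diag (suc a) = begin
  digitTerm (suc a) (suc a) (suc a)                   ≡⟨ digitTerm-split (suc a) (suc a) (suc a) ⟩
  νℕ (suc a) (suc a) * νℕ (suc a) (suc a) * (r * s)   ≡⟨ cong (λ z → z * z * (r * s)) (νℕ-refl (suc a)) ⟩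
  (- x) * (- x) * (r * s)                             ≡⟨ solve 3 (λ x r s → (:- x) :* (:- x) :* (r :* s) := (r :* x) :* (s :* x)) refl x r s ⟩
  (r * x) * (s * x)                                   ≡⟨ cong (_* (s * x)) (recipℕ-inverseˡ a) ⟩
  1ℚ * (s * x)                                        ≡⟨ solve 2 (λ s x → con 1ℚ :* (s :* x) := s :* (con 1ℚ :+ x) :- s) refl s x ⟩
  s * (1ℚ ℚ.+ x) - s                                  ≡⟨ cong (_- s) (recipℕ-suc (suc a)) ⟩
  1ℚ - s                                              ∎
  where
  x = ℕ→ℚ (suc a)
  r = recipℕ (suc a)
  s = recipℕ (suc (suc a))

digitTerm-top : ∀ {a c} → a < c → digitTerm a c c ≡ 0ℚ - recipℕ (suc c)
digitTerm-top {a} {suc c} a<c = begin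
  digitTerm a (suc c) (suc c)                         ≡⟨ digitTerm-split a (suc c) (suc c) ⟩
  νℕ a (suc c) * νℕ (suc c) (suc c) * (r * s)         ≡⟨ cong₂ (λ y z → y * z * (r * s)) (νℕ-< a<c) (νℕ-refl (suc c)) ⟩
  1ℚ * (- x) * (r * s)                                ≡⟨ solve 3 (λ x r s → con 1ℚ :* (:- x) :* (r :* s) := con 0ℚ :- (r :* x) :* s) refl x r s ⟩
  0ℚ - (r * x) * s                                    ≡⟨ cong (λ z → 0ℚ - z * s) (recipℕ-inverseˡ c) ⟩
  0ℚ - 1ℚ * s                                         ≡⟨ cong (λ z → 0ℚ - z) (ℚP.*-identityˡ s) ⟩
  0ℚ - s                                              ∎
  where
  x = ℕ→ℚ (suc c)
  r = recipℕ (suc c)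
  s = recipℕ (suc (suc c))

digitSum-diag : ∀ {a b} → a < b → sumUpTo b (digitTerm a a) ≡ 1ℚ - recipℕ b
digitSum-diag {a} a<b =
  sumUpTo-telescoping (digitTerm a a) a 1ℚ (digitTerm-belowʳ {a}) (digitTerm-diag a)
    (λ a<j → digitTerm-above a<j a<j) a<b

digitSum-offdiag : ∀ {a c b} → a ≢ c → a < b → c < b → sumUpTo b (digitTerm a c) ≡ 0ℚ - recipℕ b
digitSum-offdiag {a} {c} a≢c a<b c<b with ℕP.<-cmp a c
... | tri< a<c _ _ =
  sumUpTo-telescoping (digitTerm a c) c 0ℚ (digitTerm-belowʳ {a}) (digitTerm-top a<c)
    (λ c<j → digitTerm-above (ℕP.<-trans a<c c<j) c<j) c<b
... | tri≈ _ a≡c _ = ⊥-elim (a≢c a≡c)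
... | tri> _ _ c<a =
  sumUpTo-telescoping (digitTerm a c) a 0ℚ (digitTerm-belowˡ {a} {c}) (trans (digitTerm-comm a c a) (digitTerm-top c<a))
    (λ a<j → digitTerm-above a<j (ℕP.<-trans c<a a<j)) a<b

sumℚ-allFin : ∀ n (t : ℕ → ℚ) → sumℚ (map (t ∘ toℕ) (allFin n)) ≡ sumUpTo n t
sumℚ-allFin n t = cong sumℚ (trans (ListP.map-tabulate id (t ∘ toℕ)) (tabulate-toℕ n t))
  where
  tabulate-toℕ : ∀ n (t : ℕ → ℚ) → tabulate {n = n} (t ∘ toℕ) ≡ applyUpTo t n
  tabulate-toℕ zero    t = refl
  tabulate-toℕ (suc n) t = cong (t 0 ∷_) (tabulate-toℕ n (t ∘ suc))

restrict : ∀ {A : Set} → (A → Bool) → (A → ℚ) → A → ℚ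
restrict P f x = if P x then f x else 0ℚ

sumℚ-filterᵇ : ∀ {A : Set} (P : A → Bool) (f : A → ℚ) xs →
  sumℚ (map f (filterᵇ P xs)) ≡ sumℚ (map (restrict P f) xs)
sumℚ-filterᵇ P f [] = refl
sumℚ-filterᵇ P f (x ∷ xs) with P x
... | true  = cong (f x ℚ.+_) (sumℚ-filterᵇ P f xs)
... | false = trans (sumℚ-filterᵇ P f xs) (sym (ℚP.+-identityˡ _))

φ-dig : ∀ {b} (u x : Fin b) → φ b u (dig x) ≡ sumUpTo b (digitTerm (toℕ x) (toℕ u))
φ-dig {b} u x = begin
  φ b u (dig x)                                             ≡⟨ sumℚ-filterᵇ inRange term (allFin b) ⟩
  sumℚ (map (restrict inRange term) (allFin b))             ≡⟨ cong sumℚ (ListP.map-cong restricted (allFin b)) ⟩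
  sumℚ (map (digitTerm (toℕ x) (toℕ u) ∘ toℕ) (allFin b))  ≡⟨ sumℚ-allFin b (digitTerm (toℕ x) (toℕ u)) ⟩
  sumUpTo b (digitTerm (toℕ x) (toℕ u))                     ∎
  where
  inRange : Fin b → Bool
  inRange j = ⌊ (1 ⊔ toℕ x) ℕ.≤? toℕ j ⌋
  term : Fin b → ℚ
  term j = (ν b (dig x) (dig j) * ν b (dig u) (dig j)) ÷ₜ ℕ→ℚ (toℕ j ℕ.* suc (toℕ j))
  restricted : ∀ j → restrict inRange term j ≡ digitTerm (toℕ x) (toℕ u) (toℕ j)
  restricted j with (1 ⊔ toℕ x) ℕ.≤? toℕ j
  ... | yes _ = cong₂ (λ y z → (y * z) ÷ₜ ℕ→ℚ (toℕ j ℕ.* suc (toℕ j))) (ν-dig x j) (ν-dig u j)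
  ... | no j≱ = sym (digitTerm-below-⊔ {toℕ x} {toℕ u} (ℕP.≰⇒> j≱))

digitSum-≡ : ∀ {b} (x : Fin b) → sumUpTo b (digitTerm (toℕ x) (toℕ x)) ≡ ℕ→ℚ (b ∸ 1) ÷ₜ ℕ→ℚ b
digitSum-≡ {suc b} x = begin
  sumUpTo (suc b) (digitTerm (toℕ x) (toℕ x))  ≡⟨ digitSum-diag (FinP.toℕ<n x) ⟩
  1ℚ - r                                       ≡⟨ cong (_- r) (sym (recipℕ-suc b)) ⟩
  r * (1ℚ ℚ.+ ℕ→ℚ b) - r                       ≡⟨ solve 2 (λ r y → r :* (con 1ℚ :+ y) :- r := y :* r) refl r (ℕ→ℚ b) ⟩
  ℕ→ℚ b * r                                    ∎
  where
  r = recipℕ (suc b)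

digitSum-≢ : ∀ {b} {x y : Fin b} → x ≢ y → sumUpTo b (digitTerm (toℕ x) (toℕ y)) ≡ (- 1ℚ) ÷ₜ ℕ→ℚ b
digitSum-≢ {b} {x} {y} x≢y = begin
  sumUpTo b (digitTerm (toℕ x) (toℕ y))  ≡⟨ digitSum-offdiag (x≢y ∘ FinP.toℕ-injective) (FinP.toℕ<n x) (FinP.toℕ<n y) ⟩
  0ℚ - recipℕ b                          ≡⟨ solve 1 (λ r → con 0ℚ :- r := (:- con 1ℚ) :* r) refl (recipℕ b) ⟩
  (- 1ℚ) ÷ₜ ℕ→ℚ b                        ∎

φ-dig-≡ : ∀ {b} {x y : Fin b} → x ≡ y → φ b y (dig x) ≡ ℕ→ℚ (b ∸ 1) ÷ₜ ℕ→ℚ b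
φ-dig-≡ {x = x} refl = trans (φ-dig x x) (digitSum-≡ x)

φ-dig-≢ : ∀ {b} {x y : Fin b} → x ≢ y → φ b y (dig x) ≡ (- 1ℚ) ÷ₜ ℕ→ℚ b
φ-dig-≢ {x = x} {y} x≢y = trans (φ-dig y x) (digitSum-≢ x≢y)

-- Factorisation over the coordinates

map-allFin-suc : ∀ {A : Set} n (f : Fin (suc n) → A) → map f (allFin (suc n)) ≡ f zero ∷ map (f ∘ suc) (allFin n)
map-allFin-suc n f =
  cong (f zero ∷_) (trans (ListP.map-tabulate suc f) (sym (ListP.map-tabulate id (f ∘ suc))))

sumℚ-map-*ˡ : ∀ {A : Set} c (f : A → ℚ) xs → sumℚ (map (λ x → c * f x) xs) ≡ c * sumℚ (map f xs)
sumℚ-map-*ˡ c f []       = sym (ℚP.*-zeroʳ c)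
sumℚ-map-*ˡ c f (x ∷ xs) =
  trans (cong (c * f x ℚ.+_) (sumℚ-map-*ˡ c f xs)) (sym (ℚP.*-distribˡ-+ c (f x) (sumℚ (map f xs))))

sumℚ-map-0 : ∀ {A : Set} (f : A → ℚ) → (∀ x → f x ≡ 0ℚ) → ∀ xs → sumℚ (map f xs) ≡ 0ℚ
sumℚ-map-0 f f≡0 []       = refl
sumℚ-map-0 f f≡0 (x ∷ xs) = cong₂ ℚ._+_ (f≡0 x) (sumℚ-map-0 f f≡0 xs)

sumℚ-concatMap : ∀ {A C D : Set} (pair : A → C → D) (F : D → ℚ) (f : A → ℚ) (h : C → ℚ) →
  (∀ x y → F (pair x y) ≡ f x * h y) →
  ∀ X Y → sumℚ (map F (concatMap (λ x → map (pair x) Y) X)) ≡ sumℚ (map f X) * sumℚ (map h Y)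
sumℚ-concatMap pair F f h F≡f*h []      Y = sym (ℚP.*-zeroˡ (sumℚ (map h Y)))
sumℚ-concatMap pair F f h F≡f*h (x ∷ X) Y = begin
  sumℚ (map F (map (pair x) Y ++ rest))             ≡⟨ cong sumℚ (ListP.map-++ F (map (pair x) Y) rest) ⟩
  sumℚ (map F (map (pair x) Y) ++ map F rest)       ≡⟨ sumℚ-++ (map F (map (pair x) Y)) (map F rest) ⟩
  sumℚ (map F (map (pair x) Y)) ℚ.+ sumℚ (map F rest) ≡⟨ cong₂ ℚ._+_ row (sumℚ-concatMap pair F f h F≡f*h X Y) ⟩
  f x * sumℚ (map h Y) ℚ.+ sumℚ (map f X) * sumℚ (map h Y)
                                                    ≡⟨ sym (ℚP.*-distribʳ-+ (sumℚ (map h Y)) (f x) (sumℚ (map f X))) ⟩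
  sumℚ (map f (x ∷ X)) * sumℚ (map h Y)             ∎
  where
  rest = concatMap (λ x → map (pair x) Y) X
  row : sumℚ (map F (map (pair x) Y)) ≡ f x * sumℚ (map h Y)
  row = begin
    sumℚ (map F (map (pair x) Y))      ≡⟨ cong sumℚ (sym (ListP.map-∘ Y)) ⟩
    sumℚ (map (F ∘ pair x) Y)          ≡⟨ cong sumℚ (ListP.map-cong (F≡f*h x) Y) ⟩
    sumℚ (map (λ y → f x * h y) Y)     ≡⟨ sumℚ-map-*ˡ (f x) h Y ⟩
    f x * sumℚ (map h Y)               ∎

restrict-∧ : ∀ {A C : Set} (P : A → Bool) (Q : C → Bool) (f : A → ℚ) (h : C → ℚ) x y →
  (if P x ∧ Q y then f x * h y else 0ℚ) ≡ restrict P f x * restrict Q h y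
restrict-∧ P Q f h x y with P x | Q y
... | true  | true  = refl
... | true  | false = sym (ℚP.*-zeroʳ (f x))
... | false | q     = sym (ℚP.*-zeroˡ (if q then h y else 0ℚ))

lhsTerm : ∀ {ℓ} (B : Fin ℓ → ℕ) → ΣB ℓ B → ΔB ℓ B → ΔB ℓ B → ℚ
lhsTerm B u v v′ = (νB B v v′ * νB B (embed u) v′)
  ÷ₜ prodOver (∁ (Gof v′)) (λ i → ℕ→ℚ (rank (v′ i) + rank (v′ i) ℕ.* rank (v′ i)))

inLhsRange : ∀ {ℓ} {B : Fin ℓ → ℕ} → Subset ℓ → ΔB ℓ B → Bool
inLhsRange G v′ = isΓ v′ ∧ ⌊ ≡-dec BoolP._≟_ (Gof v′) G ⌋

coordinateTerm : (b : ℕ) → Fin b → Δ b → Δ b → ℚ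
coordinateTerm b u₀ v₀ x = (ν b v₀ x * ν b (dig u₀) x)
  ÷ₜ (if not (isGap x) then ℕ→ℚ (rank x + rank x ℕ.* rank x) else 1ℚ)

inCoordinateRange : ∀ {b} → Bool → Δ b → Bool
inCoordinateRange g x = not (isZeroDigit x) ∧ ⌊ isGap x BoolP.≟ g ⌋

coordinateSum : (b : ℕ) → Fin b → Δ b → Bool → ℚ
coordinateSum b u₀ v₀ g = sumℚ (map (restrict (inCoordinateRange g) (coordinateTerm b u₀ v₀)) (allΔ b))

prodOver-∷ : ∀ {n} s (S : Subset n) (f : Fin (suc n) → ℚ) →
  prodOver (s ∷ S) f ≡ (if s then f zero else 1ℚ) * prodOver S (f ∘ suc)
prodOver-∷ {n} s S f = cong prodℚ (map-allFin-suc n (λ i → if lookup (s ∷ S) i then f i else 1ℚ))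

module _ {ℓ} (B : Fin (suc ℓ) → ℕ) where

  private
    B′ : Fin ℓ → ℕ
    B′ = B ∘ suc

  νB-∷ : ∀ (v : ΔB (suc ℓ) B) x w → νB B v (consΔ x w) ≡ ν (B zero) (v zero) x * νB B′ (v ∘ suc) w
  νB-∷ v x w = cong prodℚ (map-allFin-suc ℓ (λ i → ν (B i) (v i) (consΔ {B = B} x w i)))

  isΓ-∷ : ∀ x (w : ΔB ℓ B′) → isΓ (consΔ {B = B} x w) ≡ not (isZeroDigit x) ∧ isΓ w
  isΓ-∷ x w = cong (foldr _∧_ true) (map-allFin-suc ℓ (λ i → not (isZeroDigit (consΔ {B = B} x w i))))

  lhsTerm-∷ : ∀ (u : ΣB (suc ℓ) B) (v : ΔB (suc ℓ) B) x w →
    lhsTerm B u v (consΔ x w) ≡ coordinateTerm (B zero) (u zero) (v zero) x * lhsTerm B′ (u ∘ suc) (v ∘ suc) w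
  lhsTerm-∷ u v x w = begin
    (νB B v (consΔ x w) * νB B (embed u) (consΔ x w)) ÷ₜ prodOver (∁ (Gof (consΔ {B = B} x w))) d
      ≡⟨ cong₂ _÷ₜ_ (cong₂ _*_ (νB-∷ v x w) (νB-∷ (embed u) x w)) (prodOver-∷ (not (isGap x)) (∁ (Gof w)) d) ⟩
    ((a * A) * (c * C)) ÷ₜ (e * E)
      ≡⟨ cong (_÷ₜ (e * E)) (solve 4 (λ a A c C → (a :* A) :* (c :* C) := (a :* c) :* (A :* C)) refl a A c C) ⟩
    ((a * c) * (A * C)) ÷ₜ (e * E)
      ≡⟨ ÷ₜ-* (a * c) (A * C) e E ⟩
    ((a * c) ÷ₜ e) * ((A * C) ÷ₜ E)      ∎
    where
    d : Fin (suc ℓ) → ℚ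
    d i = let r = rank (consΔ {B = B} x w i) in ℕ→ℚ (r + r ℕ.* r)
    a = ν (B zero) (v zero) x
    A = νB B′ (v ∘ suc) w
    c = ν (B zero) (dig (u zero)) x
    C = νB B′ (embed (u ∘ suc)) w
    e = if not (isGap x) then d zero else 1ℚ
    E = prodOver (∁ (Gof w)) (d ∘ suc)

  inLhsRange-∷ : ∀ g (G : Subset ℓ) x (w : ΔB ℓ B′) →
    inLhsRange (g ∷ G) (consΔ {B = B} x w) ≡ inCoordinateRange g x ∧ inLhsRange G w
  inLhsRange-∷ g G x w = begin
    isΓ (consΔ {B = B} x w) ∧ ⌊ ≡-dec BoolP._≟_ (isGap x ∷ Gof w) (g ∷ G) ⌋
      ≡⟨ cong₂ _∧_ (isΓ-∷ x w) ⌊≡-dec-∷⌋ ⟩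
    (not (isZeroDigit x) ∧ isΓ w) ∧ (⌊ isGap x BoolP.≟ g ⌋ ∧ ⌊ ≡-dec BoolP._≟_ (Gof w) G ⌋)
      ≡⟨ ∧-interchange (not (isZeroDigit x)) (isΓ w) _ _ ⟩
    inCoordinateRange g x ∧ inLhsRange G w ∎
    where
    open CommutativeSemigroupProperties (CommutativeMonoid.commutativeSemigroup BoolP.∧-commutativeMonoid)
      renaming (interchange to ∧-interchange)
    head? = isGap x BoolP.≟ g
    tail? = ≡-dec BoolP._≟_ (Gof w) G
    ⌊≡-dec-∷⌋ : ⌊ ≡-dec BoolP._≟_ (isGap x ∷ Gof w) (g ∷ G) ⌋ ≡ ⌊ head? ⌋ ∧ ⌊ tail? ⌋
    ⌊≡-dec-∷⌋ = trans (⌊⌋-map′ _ _ (head? ×-dec tail?))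
      (trans (isYes≗does (head? ×-dec tail?)) (sym (cong₂ _∧_ (isYes≗does head?) (isYes≗does tail?))))

  lhsII-∷ : ∀ (u : ΣB (suc ℓ) B) (v : ΔB (suc ℓ) B) g (G : Subset ℓ) →
    lhsII B u v (g ∷ G) ≡ coordinateSum (B zero) (u zero) (v zero) g * lhsII B′ (u ∘ suc) (v ∘ suc) G
  lhsII-∷ u v g G = begin
    lhsII B u v (g ∷ G)
      ≡⟨ sumℚ-filterᵇ (inLhsRange (g ∷ G)) (lhsTerm B u v) (allΔB (suc ℓ) B) ⟩
    sumℚ (map whole (allΔB (suc ℓ) B))
      ≡⟨ sumℚ-concatMap consΔ whole first rest factor (allΔ (B zero)) (allΔB ℓ B′) ⟩
    coordinateSum (B zero) (u zero) (v zero) g * sumℚ (map rest (allΔB ℓ B′))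
      ≡⟨ cong (coordinateSum (B zero) (u zero) (v zero) g *_)
              (sym (sumℚ-filterᵇ (inLhsRange G) (lhsTerm B′ u′ v′) (allΔB ℓ B′))) ⟩
    coordinateSum (B zero) (u zero) (v zero) g * lhsII B′ u′ v′ G ∎
    where
    u′ = u ∘ suc
    v′ = v ∘ suc
    whole = restrict (inLhsRange (g ∷ G)) (lhsTerm B u v)
    first = restrict (inCoordinateRange g) (coordinateTerm (B zero) (u zero) (v zero))
    rest  = restrict (inLhsRange G) (lhsTerm B′ u′ v′)
    factor : ∀ x w → whole (consΔ x w) ≡ first x * rest w
    factor x w = trans (cong₂ (λ p y → if p then y else 0ℚ) (inLhsRange-∷ g G x w) (lhsTerm-∷ u v x w))
                       (restrict-∧ (inCoordinateRange g) (inLhsRange G)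
                                   (coordinateTerm (B zero) (u zero) (v zero)) (lhsTerm B′ u′ v′) x w)

sign : Bool → ℚ
sign s = if s then - 1ℚ else 1ℚ

negOnePow-+ : ∀ m n → negOnePow (m + n) ≡ negOnePow m * negOnePow n
negOnePow-+ zero    n = sym (ℚP.*-identityˡ (negOnePow n))
negOnePow-+ (suc m) n = trans (cong -_ (negOnePow-+ m n)) (ℚP.neg-distribˡ-* (negOnePow m) (negOnePow n))

negOnePow-∣∷∣ : ∀ {n} s (S : Subset n) → negOnePow ∣ s ∷ S ∣ ≡ sign s * negOnePow ∣ S ∣
negOnePow-∣∷∣ true  S = solve 1 (λ x → :- x := :- con 1ℚ :* x) refl (negOnePow ∣ S ∣)
negOnePow-∣∷∣ false S = sym (ℚP.*-identityˡ (negOnePow ∣ S ∣))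

signedRatio : ∀ {n} (Q Γ P D : Subset n) (f h : Fin n → ℚ) → ℚ
signedRatio Q Γ P D f h = (negOnePow (∣ Q ∣ + ∣ Γ ∣) * prodOver Γ f * prodOver P h) ÷ₜ prodOver D f

signedRatio-∷ : ∀ {n} q γ p d (Q Γ P D : Subset n) (f h : Fin (suc n) → ℚ) →
  signedRatio (q ∷ Q) (γ ∷ Γ) (p ∷ P) (d ∷ D) f h
    ≡ signedRatio (q ∷ []) (γ ∷ []) (p ∷ []) (d ∷ []) (λ _ → f zero) (λ _ → h zero)
      * signedRatio Q Γ P D (f ∘ suc) (h ∘ suc)
signedRatio-∷ q γ p d Q Γ P D f h =
  trans (peel Q Γ P D f h) (cong (_* signedRatio Q Γ P D (f ∘ suc) (h ∘ suc))
    (sym (trans (peel [] [] [] [] (λ _ → f zero) (λ _ → h zero)) (ℚP.*-identityʳ first))))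
  where
  first : ℚ
  first = (sign q * sign γ * (if γ then f zero else 1ℚ) * (if p then h zero else 1ℚ)) ÷ₜ (if d then f zero else 1ℚ)
  peel : ∀ {n} (Q Γ P D : Subset n) (f h : Fin (suc n) → ℚ) →
    signedRatio (q ∷ Q) (γ ∷ Γ) (p ∷ P) (d ∷ D) f h
      ≡ ((sign q * sign γ * (if γ then f zero else 1ℚ) * (if p then h zero else 1ℚ)) ÷ₜ (if d then f zero else 1ℚ))
        * signedRatio Q Γ P D (f ∘ suc) (h ∘ suc)
  peel Q Γ P D f h = begin
    (negOnePow (∣ q ∷ Q ∣ + ∣ γ ∷ Γ ∣) * prodOver (γ ∷ Γ) f * prodOver (p ∷ P) h) ÷ₜ prodOver (d ∷ D) f
      ≡⟨ cong₂ _÷ₜ_ (cong₂ _*_ (cong₂ _*_ signs (prodOver-∷ γ Γ f)) (prodOver-∷ p P h)) (prodOver-∷ d D f) ⟩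
    ((sq * nQ) * (sγ * nΓ) * (fγ * F) * (hp * H)) ÷ₜ (fd * Fd)
      ≡⟨ cong (_÷ₜ (fd * Fd)) (solve 8 (λ sq nQ sγ nΓ fγ F hp H →
            (sq :* nQ) :* (sγ :* nΓ) :* (fγ :* F) :* (hp :* H) := (sq :* sγ :* fγ :* hp) :* (nQ :* nΓ :* F :* H))
            refl sq nQ sγ nΓ fγ F hp H) ⟩
    ((sq * sγ * fγ * hp) * (nQ * nΓ * F * H)) ÷ₜ (fd * Fd)
      ≡⟨ ÷ₜ-* (sq * sγ * fγ * hp) (nQ * nΓ * F * H) fd Fd ⟩
    ((sq * sγ * fγ * hp) ÷ₜ fd) * ((nQ * nΓ * F * H) ÷ₜ Fd)
      ≡⟨ cong (λ z → ((sq * sγ * fγ * hp) ÷ₜ fd) * ((z * F * H) ÷ₜ Fd)) (sym (negOnePow-+ ∣ Q ∣ ∣ Γ ∣)) ⟩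
    ((sq * sγ * fγ * hp) ÷ₜ fd) * signedRatio Q Γ P D (f ∘ suc) (h ∘ suc) ∎
    where
    sq = sign q
    sγ = sign γ
    nQ = negOnePow ∣ Q ∣
    nΓ = negOnePow ∣ Γ ∣
    fγ = if γ then f zero else 1ℚ
    F = prodOver Γ (f ∘ suc)
    hp = if p then h zero else 1ℚ
    H = prodOver P (h ∘ suc)
    fd = if d then f zero else 1ℚ
    Fd = prodOver D (f ∘ suc)
    signs : negOnePow (∣ q ∷ Q ∣ + ∣ γ ∷ Γ ∣) ≡ (sq * nQ) * (sγ * nΓ)
    signs = trans (negOnePow-+ ∣ q ∷ Q ∣ ∣ γ ∷ Γ ∣) (cong₂ _*_ (negOnePow-∣∷∣ q Q) (negOnePow-∣∷∣ γ Γ))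

rhsII : ∀ {ℓ} (B : Fin ℓ → ℕ) → ΣB ℓ B → ΔB ℓ B → Subset ℓ → ℚ
rhsII B u v G =
  signedRatio (Qset u v ─ G) (Gof v) (Pset u v ─ G) (∁ G) (λ i → ℕ→ℚ (B i)) (λ i → ℕ→ℚ (B i ∸ 1))

rhsII-∷ : ∀ {ℓ} (B : Fin (suc ℓ) → ℕ) u v g (G : Subset ℓ) →
  rhsII B u v (g ∷ G)
    ≡ rhsII (λ _ → B zero) (λ _ → u zero) (λ _ → v zero) (g ∷ []) * rhsII (B ∘ suc) (u ∘ suc) (v ∘ suc) G
-- The first entries of Qset u v ─ (g ∷ G) and Pset u v ─ (g ∷ G) only compute once g is known.
rhsII-∷ B u v g G =
  signedRatio-∷ (head (Qset u v ─ (g ∷ G))) (head (Gof v)) (head (Pset u v ─ (g ∷ G))) (not g)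
    (Qset (u ∘ suc) (v ∘ suc) ─ G) (Gof (v ∘ suc)) (Pset (u ∘ suc) (v ∘ suc) ─ G) (∁ G)
    (λ i → ℕ→ℚ (B i)) (λ i → ℕ→ℚ (B i ∸ 1))

coordinateSum-gap : ∀ b (u₀ : Fin b) v₀ → coordinateSum b u₀ v₀ true ≡ ν b v₀ gap
coordinateSum-gap b u₀ v₀ = begin
  coordinateTerm b u₀ v₀ gap ℚ.+ sumℚ (map term (map dig (allFin b)))
    ≡⟨ cong (coordinateTerm b u₀ v₀ gap ℚ.+_) (trans (cong sumℚ (sym (ListP.map-∘ (allFin b))))
                                                      (sumℚ-map-0 (term ∘ dig) digit≡0 (allFin b))) ⟩
  (ν b v₀ gap * 1ℚ) * 1ℚ ℚ.+ 0ℚ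
    ≡⟨ solve 1 (λ y → (y :* con 1ℚ) :* con 1ℚ :+ con 0ℚ := y) refl (ν b v₀ gap) ⟩
  ν b v₀ gap ∎
  where
  term = restrict (inCoordinateRange true) (coordinateTerm b u₀ v₀)
  digit≡0 : ∀ j → term (dig j) ≡ 0ℚ
  digit≡0 j rewrite BoolP.∧-zeroʳ (not (isZeroDigit (dig {b} j))) = refl

coordinateSum-dig : ∀ b (u₀ x : Fin b) → coordinateSum b u₀ (dig x) false ≡ sumUpTo b (digitTerm (toℕ x) (toℕ u₀))
coordinateSum-dig b u₀ x = begin
  0ℚ ℚ.+ sumℚ (map term (map dig (allFin b)))               ≡⟨ ℚP.+-identityˡ _ ⟩
  sumℚ (map term (map dig (allFin b)))                      ≡⟨ cong sumℚ (sym (ListP.map-∘ (allFin b))) ⟩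
  sumℚ (map (term ∘ dig) (allFin b))                        ≡⟨ cong sumℚ (ListP.map-cong restricted (allFin b)) ⟩
  sumℚ (map (digitTerm (toℕ x) (toℕ u₀) ∘ toℕ) (allFin b))  ≡⟨ sumℚ-allFin b (digitTerm (toℕ x) (toℕ u₀)) ⟩
  sumUpTo b (digitTerm (toℕ x) (toℕ u₀))                     ∎
  where
  term = restrict (inCoordinateRange false) (coordinateTerm b u₀ (dig x))
  restricted : ∀ j → term (dig j) ≡ digitTerm (toℕ x) (toℕ u₀) (toℕ j)
  restricted zero    = sym (digitTerm-zero (toℕ x) (toℕ u₀))
  restricted j@(suc _) =
    cong₂ (λ y n → y ÷ₜ ℕ→ℚ n) (cong₂ _*_ (ν-dig x j) (ν-dig u₀ j)) (sym (ℕP.*-suc (toℕ j) (toℕ j)))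

coordinateSum≡rhsII : ∀ b (u₀ : Fin b) v₀ g → (isGap v₀ ≡ true → g ≡ true) →
  coordinateSum b u₀ v₀ g ≡ rhsII (λ _ → b) (λ _ → u₀) (λ _ → v₀) (g ∷ [])
coordinateSum≡rhsII b u₀ gap     true  _ =
  trans (coordinateSum-gap b u₀ gap)
        (solve 1 (λ n → :- n := (:- con 1ℚ :* (n :* con 1ℚ) :* (con 1ℚ :* con 1ℚ)) :* con 1ℚ) refl (ℕ→ℚ b))
coordinateSum≡rhsII b u₀ (dig x) true  _ = coordinateSum-gap b u₀ (dig x)
coordinateSum≡rhsII b u₀ gap     false gap⇒g with gap⇒g refl
... | ()
coordinateSum≡rhsII b u₀ (dig x) false _ with x Fin.≟ u₀
... | yes refl =
  trans (coordinateSum-dig b x x) (trans (digitSum-≡ x)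
    (cong₂ _÷ₜ_ (solve 1 (λ n → n := con 1ℚ :* (con 1ℚ :* con 1ℚ) :* (n :* con 1ℚ)) refl (ℕ→ℚ (b ∸ 1)))
                (sym (ℚP.*-identityʳ (ℕ→ℚ b)))))
... | no x≢u₀ =
  trans (coordinateSum-dig b u₀ x) (trans (digitSum-≢ x≢u₀)
    (cong₂ _÷ₜ_ (solve 0 (:- con 1ℚ := :- con 1ℚ :* (con 1ℚ :* con 1ℚ) :* (con 1ℚ :* con 1ℚ)) refl)
                (sym (ℚP.*-identityʳ (ℕ→ℚ b)))))

∷⊆∷-head : ∀ {n} {s t} {S T : Subset n} → s ∷ S ⊆ t ∷ T → s ≡ true → t ≡ true
∷⊆∷-head sS⊆tT refl with sS⊆tT here
... | here = refl

lhsII≡rhsII : ∀ {ℓ} (B : Fin ℓ → ℕ) (u : ΣB ℓ B) (v : ΔB ℓ B) (G : Subset ℓ) →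
  Gof v ⊆ G → lhsII B u v G ≡ rhsII B u v G
lhsII≡rhsII {zero}  B u v []      _     = refl
lhsII≡rhsII {suc ℓ} B u v (g ∷ G) Gv⊆G = begin
  lhsII B u v (g ∷ G)
    ≡⟨ lhsII-∷ B u v g G ⟩
  coordinateSum (B zero) (u zero) (v zero) g * lhsII (B ∘ suc) (u ∘ suc) (v ∘ suc) G
    ≡⟨ cong₂ _*_ (coordinateSum≡rhsII (B zero) (u zero) (v zero) g (∷⊆∷-head Gv⊆G))
                 (lhsII≡rhsII (B ∘ suc) (u ∘ suc) (v ∘ suc) G (drop-∷-⊆ Gv⊆G)) ⟩
  rhsII (λ _ → B zero) (λ _ → u zero) (λ _ → v zero) (g ∷ []) * rhsII (B ∘ suc) (u ∘ suc) (v ∘ suc) G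
    ≡⟨ sym (rhsII-∷ B u v g G) ⟩
  rhsII B u v (g ∷ G) ∎

proposition3 : (ℓ : ℕ) → 1 ≤ ℓ → (B : Fin ℓ → ℕ) → ((i : Fin ℓ) → 2 ≤ B i) →
    (u : ΣB ℓ B) → (v : ΔB ℓ B) →
    (((i : Fin ℓ) → (x : Fin (B i)) → v i ≡ dig x →
        (x ≡ u i → φ (B i) (u i) (v i) ≡ ℕ→ℚ (B i ∸ 1) ÷ₜ ℕ→ℚ (B i))
      × (x ≢ u i → φ (B i) (u i) (v i) ≡ (- 1ℚ) ÷ₜ ℕ→ℚ (B i)))
    × ((G : Subset ℓ) → Gof v ⊆ G →
        lhsII B u v G
          ≡ (negOnePow (∣ Qset u v ─ G ∣ + ∣ Gof v ∣)
              * prodOver (Gof v) (λ i → ℕ→ℚ (B i))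
              * prodOver (Pset u v ─ G) (λ i → ℕ→ℚ (B i ∸ 1)))
            ÷ₜ prodOver (∁ G) (λ i → ℕ→ℚ (B i))))
proposition3 ℓ _ B _ u v = partI , lhsII≡rhsII B u v
  where
  partI : (i : Fin ℓ) (x : Fin (B i)) → v i ≡ dig x →
    (x ≡ u i → φ (B i) (u i) (v i) ≡ ℕ→ℚ (B i ∸ 1) ÷ₜ ℕ→ℚ (B i))
    × (x ≢ u i → φ (B i) (u i) (v i) ≡ (- 1ℚ) ÷ₜ ℕ→ℚ (B i))
  partI i x vi≡x rewrite vi≡x = φ-dig-≡ , φ-dig-≢
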